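{- Let $C$ be a linear code over $\mathbb{F}_q$ of dimension $k$ with higher weights $d_1,\dots,d_k$. Assume there exists an integer $\alpha$ such that \[d_i=\alpha\,\frac{q^i-1}{q^{i-1}(q-1)} \quad\text{for all } 1\leq i\leq k.\] Then $C$ is a constant weight code, and every nonzero codeword has weight $\alpha$.
   Context: A linear code $C$ is a subspace of $\mathbb{F}_q^n$ of dimension $k$. For a subcode (linear subspace) $D\subseteq C$, $\mathrm{Supp}(D)=\{x\in\{1,\dots,n\}: \exists\, c\in D,\ c_x\neq0\}$ and $w(D)=\#\mathrm{Supp}(D)$; the weight of a codeword is the weight of the subcode it spans. The higher weights are $d_r=\min\{w(D): D\subseteq C \text{ a subcode of dimension } r\}$. A code is of constant weight if all nonzero codewords have the same weight. -}

module Defs where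

open import Level using (0ℓ)
open import Data.Nat using (ℕ; _≤_)
open import Data.Fin using (Fin)
open import Data.Fin.Subset using (Subset; _∈_; ∣_∣)
open import Data.Product using (Σ; ∃; _×_)
open import Function.Bundles using (_⇔_)
open import Relation.Nullary using (¬_)
open import Relation.Binary.Definitions using (Decidable)
open import Relation.Binary.PropositionalEquality using (_≡_)
open import Algebra.Bundles using (CommutativeRing)
import Algebra.Definitions.RawMonoid as RM

record FiniteField (q : ℕ) : Set₁ where
  field
    commRing : CommutativeRing 0ℓ 0ℓ
  open CommutativeRing commRing public
  field
    _≟_      : Decidable _≈_
    1≉0      : ¬ (1# ≈ 0#)
    inverse  : ∀ x → ¬ (x ≈ 0#) → ∃ λ y → (x * y) ≈ 1#
    enum     : Fin q → Carrier
    enum-inj : ∀ i j → enum i ≈ enum j → i ≡ j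
    enum-sur : ∀ x → ∃ λ i → enum i ≈ x

module Codes {q : ℕ} (F : FiniteField q) where
  open FiniteField F
  open RM +-rawMonoid using (sum)

  Word : ℕ → Set
  Word n = Fin n → Carrier

  lin : ∀ {n r} → (Fin r → Carrier) → (Fin r → Word n) → Word n
  lin λs g x = sum (λ i → λs i * g i x)

  InSpan : ∀ {n r} → (Fin r → Word n) → Word n → Set
  InSpan {r = r} g c = ∃ λ (λs : Fin r → Carrier) → ∀ x → c x ≈ lin λs g x

  LinIndep : ∀ {n r} → (Fin r → Word n) → Set
  LinIndep {n} {r} g =
    ∀ (λs : Fin r → Carrier) → (∀ x → lin λs g x ≈ 0#) → ∀ i → λs i ≈ 0#

  -- A linear code of length n and dimension k is given by a basis
  -- G : Fin k → Word n (a generator matrix); C = span of G.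
  IsSubcode : ∀ {n k r} → (G : Fin k → Word n) → (Fin r → Word n) → Set
  IsSubcode G B = LinIndep B × (∀ j → InSpan G (B j))

  InSupp : ∀ {n r} → (Fin r → Word n) → Fin n → Set
  InSupp B x = ∃ λ c → InSpan B c × ¬ (c x ≈ 0#)

  HasWeight : ∀ {n r} → (Fin r → Word n) → ℕ → Set
  HasWeight {n} B m =
    ∃ λ (S : Subset n) → (∣ S ∣ ≡ m) × (∀ x → (x ∈ S) ⇔ InSupp B x)

  WordWeight : ∀ {n} → Word n → ℕ → Set
  WordWeight c m = HasWeight {r = 1} (λ _ → c) m

  IsZeroWord : ∀ {n} → Word n → Set
  IsZeroWord c = ∀ x → c x ≈ 0#

  IsHigherWeight : ∀ {n k} → (Fin k → Word n) → (r d : ℕ) → Set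
  IsHigherWeight {n} G r d =
    (∃ λ (B : Fin r → Word n) → IsSubcode G B × HasWeight B d)
    × (∀ (B : Fin r → Word n) → IsSubcode G B → ∀ m → HasWeight B m → d ≤ m)

  ConstantWeight : ∀ {n k} → (Fin k → Word n) → Set
  ConstantWeight G =
    ∀ c c′ m m′ → InSpan G c → ¬ IsZeroWord c → InSpan G c′ → ¬ IsZeroWord c′
      → WordWeight c m → WordWeight c′ m′ → m ≡ m′

-- Average the weights of all q^k codewords v·G of a basis G.  Each coordinate of
-- Supp C is nonzero in exactly q^(k-1)(q-1) of them (a nonzero linear form takes
-- the value 0 on a 1/q fraction of F_q^k), so Σ_v wt(v·G) = q^(k-1)(q-1)·|Supp C|.
-- A k-dimensional subcode of C is C itself (Steinitz exchange), so |Supp C| ≤ d_k,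
-- and the hypothesis at i = 1 and i = k gives d_1 = α and
-- q^(k-1)(q-1)·d_k = α(q^k - 1).  Hence the q^k - 1 nonzero codewords have total
-- weight at most α(q^k - 1) while each weighs at least d_1 = α: all weigh α.

module Submission where

open import Defs
open import Data.Nat using (ℕ; zero; suc; _≤_; z≤n; s≤s)
open import Data.Fin using (Fin; zero; suc; punchIn)
open import Data.Product using (∃; _×_; _,_; proj₁; proj₂; uncurry)
open import Data.Vec using (Vec; []; _∷_)
open import Function using (_∘_)
open import Function.Bundles using (_⇔_; mk⇔; Equivalence)
open import Relation.Nullary using (¬_; Dec; yes; no; does; ¬?; contradiction)
open import Relation.Binary.PropositionalEquality using (_≡_; _≢_)

module Counting where

  open import Data.Nat using (_+_; _*_; _∸_; _^_)
  open import Data.Nat.Properties as ℕ using (+-*-semiring)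
  open import Data.Fin.Properties using (punchInᵢ≢i)
  open import Data.Fin.Subset using (Subset; _∈_; ∣_∣; inside; outside)
  open import Data.Fin.Subset.Properties using (drop-there)
  open import Data.Vec.Base using (here; there)
  open import Data.Vec.Properties using (∷-injectiveˡ; ∷-injectiveʳ; ≡-dec)
  import Data.Fin as Fin
  import Function.Properties.Equivalence as ⇔
  open import Relation.Unary using (Decidable)
  open import Relation.Binary.PropositionalEquality
    using (refl; sym; trans; cong; cong₂; module ≡-Reasoning)
  open import Algebra.Properties.Semiring.Sum +-*-semiring
    using (sum; sum-syntax; sum-cong-≗; sum-remove; ∑-distrib-+; ∑-comm; *-distribˡ-sum)

  𝟙 : ∀ {p} {P : Set p} → Dec P → ℕ
  𝟙 (yes _) = 1
  𝟙 (no _)  = 0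

  module _ {p} {P : Set p} where

    𝟙-yes : (P? : Dec P) → P → 𝟙 P? ≡ 1
    𝟙-yes (yes _) _  = refl
    𝟙-yes (no ¬p) p = contradiction p ¬p

    𝟙-no : (P? : Dec P) → ¬ P → 𝟙 P? ≡ 0
    𝟙-no (yes p) ¬p = contradiction p ¬p
    𝟙-no (no _)  _  = refl

  𝟙-mono : ∀ {p q} {P : Set p} {Q : Set q} (P? : Dec P) (Q? : Dec Q) →
           (P → Q) → 𝟙 P? ≤ 𝟙 Q?
  𝟙-mono (yes p) Q? P⇒Q = ℕ.≤-reflexive (sym (𝟙-yes Q? (P⇒Q p)))
  𝟙-mono (no _)  Q? P⇒Q = z≤n

  𝟙-cong : ∀ {p q} {P : Set p} {Q : Set q} (P? : Dec P) (Q? : Dec Q) →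
           P ⇔ Q → 𝟙 P? ≡ 𝟙 Q?
  𝟙-cong P? Q? P⇔Q =
    ℕ.≤-antisym (𝟙-mono P? Q? (Equivalence.to P⇔Q)) (𝟙-mono Q? P? (Equivalence.from P⇔Q))

  suc∈∷⇔∈ : ∀ {n s x} {S : Subset n} → suc x ∈ s ∷ S ⇔ x ∈ S
  suc∈∷⇔∈ = mk⇔ drop-there there

  toSubset : ∀ {p n} {P : Fin n → Set p} → Decidable P → Subset n
  toSubset {n = zero}  P? = []
  toSubset {n = suc n} P? = does (P? zero) ∷ toSubset (P? ∘ suc)

  ∈-toSubset : ∀ {p n} {P : Fin n → Set p} (P? : Decidable P) x → x ∈ toSubset P? ⇔ P x
  ∈-toSubset P? zero with P? zero
  ... | yes p  = mk⇔ (λ _ → p) (λ _ → here)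
  ... | no  ¬p = mk⇔ (λ ()) (λ p → contradiction p ¬p)
  ∈-toSubset P? (suc x) = ⇔.trans suc∈∷⇔∈ (∈-toSubset (P? ∘ suc) x)

  ∣∣≡∑𝟙 : ∀ {p n} {P : Fin n → Set p} (S : Subset n) (P? : Decidable P) →
          (∀ x → x ∈ S ⇔ P x) → ∣ S ∣ ≡ ∑[ x < n ] 𝟙 (P? x)
  ∣∣≡∑𝟙 []            P? S⇔P = refl
  ∣∣≡∑𝟙 (inside ∷ S) P? S⇔P = cong₂ _+_
    (sym (𝟙-yes (P? zero) (Equivalence.to (S⇔P zero) here)))
    (∣∣≡∑𝟙 S (P? ∘ suc) (λ x → ⇔.trans (⇔.sym suc∈∷⇔∈) (S⇔P (suc x))))
  ∣∣≡∑𝟙 (outside ∷ S) P? S⇔P = cong₂ _+_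
    (sym (𝟙-no (P? zero) ((λ ()) ∘ Equivalence.from (S⇔P zero))))
    (∣∣≡∑𝟙 S (P? ∘ suc) (λ x → ⇔.trans (⇔.sym suc∈∷⇔∈) (S⇔P (suc x))))

  sum-const : ∀ n c → ∑[ i < n ] c ≡ n * c
  sum-const zero    c = refl
  sum-const (suc n) c = cong (c +_) (sum-const n c)

  sum-mono-≤ : ∀ {n} {f g : Fin n → ℕ} → (∀ i → f i ≤ g i) → sum f ≤ sum g
  sum-mono-≤ {zero}  f≤g = z≤n
  sum-mono-≤ {suc n} f≤g = ℕ.+-mono-≤ (f≤g zero) (sum-mono-≤ (f≤g ∘ suc))

  sum-tight : ∀ {n} {f g : Fin n → ℕ} → (∀ i → g i ≤ f i) → sum f ≤ sum g →
              ∀ i → f i ≤ g i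
  sum-tight {suc n} {f} {g} g≤f Σf≤Σg i =
    ℕ.+-cancelʳ-≤ (sum (g ∘ punchIn i)) (f i) (g i) (begin
      f i + sum (g ∘ punchIn i)  ≤⟨ ℕ.+-monoʳ-≤ (f i) (sum-mono-≤ (g≤f ∘ punchIn i)) ⟩
      f i + sum (f ∘ punchIn i)  ≡⟨ sum-remove f ⟨
      sum f                      ≤⟨ Σf≤Σg ⟩
      sum g                      ≡⟨ sum-remove g ⟩
      g i + sum (g ∘ punchIn i)  ∎)
    where open ℕ.≤-Reasoning

  sum-except : ∀ {n} (f : Fin n → ℕ) (i : Fin n) {e} → (∀ j → j ≢ i → f j ≡ e) →
               sum f ≡ f i + (n ∸ 1) * e
  sum-except {suc n} f i {e} f≡e = begin
    sum f
      ≡⟨ sum-remove f ⟩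
    f i + sum (f ∘ punchIn i)
      ≡⟨ cong (f i +_) (sum-cong-≗ (λ j → f≡e (punchIn i j) (punchInᵢ≢i i j))) ⟩
    f i + ∑[ j < n ] e
      ≡⟨ cong (f i +_) (sum-const n e) ⟩
    f i + n * e ∎
    where open ≡-Reasoning

  ∑𝟙¬≡n∸1 : ∀ {p n} {P : Fin n → Set p} (P? : Decidable P) t₀ →
            (∀ t → P t ⇔ t ≡ t₀) → ∑[ t < n ] 𝟙 (¬? (P? t)) ≡ n ∸ 1
  ∑𝟙¬≡n∸1 {n = n} P? t₀ P⇔≡t₀ = begin
    ∑[ t < n ] 𝟙 (¬? (P? t))
      ≡⟨ sum-except _ t₀ (λ t t≢t₀ → 𝟙-yes (¬? (P? t)) (t≢t₀ ∘ Equivalence.to (P⇔≡t₀ t))) ⟩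
    𝟙 (¬? (P? t₀)) + (n ∸ 1) * 1
      ≡⟨ cong₂ _+_ (𝟙-no (¬? (P? t₀)) (λ ¬P → ¬P (Equivalence.from (P⇔≡t₀ t₀) refl)))
                   (ℕ.*-identityʳ (n ∸ 1)) ⟩
    n ∸ 1 ∎
    where open ≡-Reasoning

  2≤-of-distinct : ∀ {n} {i j : Fin n} → i ≢ j → 2 ≤ n
  2≤-of-distinct {suc zero}    {zero} {zero} i≢j = contradiction refl i≢j
  2≤-of-distinct {suc (suc n)}               _   = s≤s (s≤s z≤n)

  -- Coefficient vectors are inductive, so that ∑ⱽ-tight concludes at every vector
  -- (for functions Fin k → Fin q this would need function extensionality).
  module VectorSum (q : ℕ) where

    ∑ⱽ : ∀ k → (Vec (Fin q) k → ℕ) → ℕ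
    ∑ⱽ zero    f = f []
    ∑ⱽ (suc k) f = ∑[ t < q ] ∑ⱽ k (λ v → f (t ∷ v))

    ∑ⱽ-cong : ∀ k {f g : Vec (Fin q) k → ℕ} → (∀ v → f v ≡ g v) → ∑ⱽ k f ≡ ∑ⱽ k g
    ∑ⱽ-cong zero    f≡g = f≡g []
    ∑ⱽ-cong (suc k) f≡g = sum-cong-≗ (λ t → ∑ⱽ-cong k (λ v → f≡g (t ∷ v)))

    ∑ⱽ-distrib-+ : ∀ k (f g : Vec (Fin q) k → ℕ) →
                   ∑ⱽ k (λ v → f v + g v) ≡ ∑ⱽ k f + ∑ⱽ k g
    ∑ⱽ-distrib-+ zero    f g = refl
    ∑ⱽ-distrib-+ (suc k) f g = trans
      (sum-cong-≗ (λ t → ∑ⱽ-distrib-+ k (λ v → f (t ∷ v)) (λ v → g (t ∷ v))))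
      (∑-distrib-+ (λ t → ∑ⱽ k (λ v → f (t ∷ v))) (λ t → ∑ⱽ k (λ v → g (t ∷ v))))

    ∑ⱽ-*ˡ : ∀ k c (f : Vec (Fin q) k → ℕ) → ∑ⱽ k (λ v → c * f v) ≡ c * ∑ⱽ k f
    ∑ⱽ-*ˡ zero    c f = refl
    ∑ⱽ-*ˡ (suc k) c f = trans
      (sum-cong-≗ (λ t → ∑ⱽ-*ˡ k c (λ v → f (t ∷ v))))
      (sym (*-distribˡ-sum c (λ t → ∑ⱽ k (λ v → f (t ∷ v)))))

    ∑ⱽ-const : ∀ k c → ∑ⱽ k (λ _ → c) ≡ q ^ k * c
    ∑ⱽ-const zero    c = sym (ℕ.*-identityˡ c)
    ∑ⱽ-const (suc k) c = begin
      ∑[ t < q ] ∑ⱽ k (λ _ → c)  ≡⟨ sum-cong-≗ {q} (λ _ → ∑ⱽ-const k c) ⟩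
      ∑[ t < q ] (q ^ k * c)     ≡⟨ sum-const q _ ⟩
      q * (q ^ k * c)            ≡⟨ ℕ.*-assoc q _ c ⟨
      q ^ suc k * c              ∎
      where open ≡-Reasoning

    ∑ⱽ-comm : ∀ k {n} (h : Vec (Fin q) k → Fin n → ℕ) →
              ∑ⱽ k (λ v → ∑[ x < n ] h v x) ≡ ∑[ x < n ] ∑ⱽ k (λ v → h v x)
    ∑ⱽ-comm zero    h = refl
    ∑ⱽ-comm (suc k) h = trans
      (sum-cong-≗ (λ t → ∑ⱽ-comm k (λ v → h (t ∷ v))))
      (∑-comm (λ t x → ∑ⱽ k (λ v → h (t ∷ v) x)))

    ∑ⱽ-mono-≤ : ∀ k {f g : Vec (Fin q) k → ℕ} → (∀ v → f v ≤ g v) → ∑ⱽ k f ≤ ∑ⱽ k g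
    ∑ⱽ-mono-≤ zero    f≤g = f≤g []
    ∑ⱽ-mono-≤ (suc k) f≤g = sum-mono-≤ (λ t → ∑ⱽ-mono-≤ k (λ v → f≤g (t ∷ v)))

    ∑ⱽ-tight : ∀ k {f g : Vec (Fin q) k → ℕ} → (∀ v → g v ≤ f v) →
               ∑ⱽ k f ≤ ∑ⱽ k g → ∀ v → f v ≤ g v
    ∑ⱽ-tight zero    g≤f Σf≤Σg [] = Σf≤Σg
    ∑ⱽ-tight (suc k) g≤f Σf≤Σg (t ∷ v) = ∑ⱽ-tight k (λ w → g≤f (t ∷ w))
      (sum-tight (λ s → ∑ⱽ-mono-≤ k (λ w → g≤f (s ∷ w))) Σf≤Σg t) v

    ∑ⱽ-single : ∀ k {f : Vec (Fin q) k → ℕ} u → (∀ v → v ≢ u → f v ≡ 0) →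
                ∑ⱽ k f ≡ f u
    ∑ⱽ-single zero    [] _ = refl
    ∑ⱽ-single (suc k) {f} (s ∷ u) f≡0 = begin
      ∑[ t < q ] ∑ⱽ k (λ v → f (t ∷ v))
        ≡⟨ sum-except _ s outside-s ⟩
      ∑ⱽ k (λ v → f (s ∷ v)) + (q ∸ 1) * 0
        ≡⟨ cong₂ _+_ (∑ⱽ-single k u (λ v v≢u → f≡0 (s ∷ v) (v≢u ∘ ∷-injectiveʳ)))
                     (ℕ.*-zeroʳ (q ∸ 1)) ⟩
      f (s ∷ u) + 0
        ≡⟨ ℕ.+-identityʳ _ ⟩
      f (s ∷ u) ∎
      where
      open ≡-Reasoning
      outside-s : ∀ t → t ≢ s → ∑ⱽ k (λ v → f (t ∷ v)) ≡ 0
      outside-s t t≢s = begin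
        ∑ⱽ k (λ v → f (t ∷ v))
          ≡⟨ ∑ⱽ-cong k (λ v → f≡0 (t ∷ v) (t≢s ∘ ∷-injectiveˡ)) ⟩
        ∑ⱽ k (λ _ → 0)
          ≡⟨ ∑ⱽ-const k 0 ⟩
        q ^ k * 0
          ≡⟨ ℕ.*-zeroʳ (q ^ k) ⟩
        0 ∎

    ∑ⱽ-𝟙≡ : ∀ k (u : Vec (Fin q) k) → ∑ⱽ k (λ v → 𝟙 (≡-dec Fin._≟_ v u)) ≡ 1
    ∑ⱽ-𝟙≡ k u = trans (∑ⱽ-single k u (λ v v≢u → 𝟙-no (≡-dec Fin._≟_ v u) v≢u))
                      (𝟙-yes (≡-dec Fin._≟_ u u) refl)

module LinearAlgebra {q : ℕ} (F : FiniteField q) where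

  open import Data.Nat.Properties using (m≤n⇒m≤1+n; 1+n≰n)
  open import Data.Fin.Properties using (any?)
  import Data.Vec.Functional as Vector
  open import Data.Vec.Functional.Properties using (insertAt-lookup; insertAt-punchIn)
  open import Data.Vec using (lookup; tabulate)
  open import Data.Vec.Properties using (lookup∘tabulate; tabulate∘lookup; tabulate-cong)
  open import Relation.Nullary.Decidable using (decidable-stable)
  import Relation.Binary.PropositionalEquality as ≡

  open FiniteField F hiding (zero)
  open Codes F
  open Counting using (2≤-of-distinct)
  open import Algebra.Properties.Semiring.Sum semiring as Σ
    using (sum-cong-≋; sum-replicate-zero; *-distribʳ-sum)
  open import Algebra.Properties.Group +-group using (inverseˡ-unique)
  open import Algebra.Properties.Ring ring using (-‿distribˡ-*)
  open import Relation.Binary.Reasoning.Setoid setoid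

  x*y≈0⇒y≈0 : ∀ {x y} → ¬ x ≈ 0# → x * y ≈ 0# → y ≈ 0#
  x*y≈0⇒y≈0 {x} {y} x≉0 xy≈0 with inverse x x≉0
  ... | x⁻¹ , xx⁻¹≈1 = begin
    y              ≈⟨ *-identityˡ y ⟨
    1# * y         ≈⟨ *-congʳ (trans (sym xx⁻¹≈1) (*-comm x x⁻¹)) ⟩
    (x⁻¹ * x) * y  ≈⟨ *-assoc x⁻¹ x y ⟩
    x⁻¹ * (x * y)  ≈⟨ *-congˡ xy≈0 ⟩
    x⁻¹ * 0#       ≈⟨ zeroʳ x⁻¹ ⟩
    0#             ∎

  affine-root : ∀ {a a⁻¹ s x} → a * a⁻¹ ≈ 1# → x * a + s ≈ 0# → x ≈ - (s * a⁻¹)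
  affine-root {a} {a⁻¹} {s} {x} aa⁻¹≈1 xa+s≈0 = begin
    x              ≈⟨ *-identityʳ x ⟨
    x * 1#         ≈⟨ *-congˡ aa⁻¹≈1 ⟨
    x * (a * a⁻¹)  ≈⟨ *-assoc x a a⁻¹ ⟨
    (x * a) * a⁻¹  ≈⟨ *-congʳ (inverseˡ-unique (x * a) s xa+s≈0) ⟩
    - s * a⁻¹      ≈⟨ -‿distribˡ-* s a⁻¹ ⟨
    - (s * a⁻¹)    ∎

  affine-root-zero : ∀ {a a⁻¹} s → a * a⁻¹ ≈ 1# → - (s * a⁻¹) * a + s ≈ 0#
  affine-root-zero {a} {a⁻¹} s aa⁻¹≈1 = begin
    - (s * a⁻¹) * a + s
      ≈⟨ +-congʳ (-‿distribˡ-* (s * a⁻¹) a) ⟨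
    - (s * a⁻¹ * a) + s
      ≈⟨ +-congʳ (-‿cong (trans (*-assoc s a⁻¹ a) (*-congˡ (trans (*-comm a⁻¹ a) aa⁻¹≈1)))) ⟩
    - (s * 1#) + s
      ≈⟨ +-congʳ (-‿cong (*-identityʳ s)) ⟩
    - s + s
      ≈⟨ -‿inverseˡ s ⟩
    0# ∎

  nonzero? : ∀ {k} (a : Fin k → Carrier) → Dec (∃ λ i → ¬ a i ≈ 0#)
  nonzero? a = any? (λ i → ¬? (a i ≟ 0#))

  ¬nonzero⇒≈0 : ∀ {k} {a : Fin k → Carrier} → ¬ (∃ λ i → ¬ a i ≈ 0#) →
                ∀ i → a i ≈ 0#
  ¬nonzero⇒≈0 {a = a} ¬nz i = decidable-stable (a i ≟ 0#) (λ aᵢ≉0 → ¬nz (i , aᵢ≉0))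

  nonzero-entry : ∀ {k} (a : Fin k → Carrier) → ¬ (∀ i → a i ≈ 0#) →
                  ∃ λ i → ¬ a i ≈ 0#
  nonzero-entry a a≉0 with nonzero? a
  ... | yes nz  = nz
  ... | no  ¬nz = contradiction (¬nonzero⇒≈0 ¬nz) a≉0

  lin-cong : ∀ {n r} {u u′ : Fin r → Carrier} (g : Fin r → Word n) x →
             (∀ i → u i ≈ u′ i) → lin u g x ≈ lin u′ g x
  lin-cong g x u≈u′ = sum-cong-≋ (λ i → *-congʳ (u≈u′ i))

  lin-zero : ∀ {n r} (u : Fin r → Carrier) (g : Fin r → Word n) x →
             (∀ i → u i * g i x ≈ 0#) → lin u g x ≈ 0#
  lin-zero {r = r} u g x terms≈0 = trans (sum-cong-≋ terms≈0) (sum-replicate-zero r)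

  lin-zeroʳ : ∀ {n r} (u : Fin r → Carrier) (g : Fin r → Word n) x →
              (∀ i → g i x ≈ 0#) → lin u g x ≈ 0#
  lin-zeroʳ u g x g≈0 = lin-zero u g x (λ i → trans (*-congˡ (g≈0 i)) (zeroʳ (u i)))

  δ : ∀ {r} → Fin r → Fin r → Carrier
  δ zero    zero    = 1#
  δ zero    (suc i) = 0#
  δ (suc j) zero    = 0#
  δ (suc j) (suc i) = δ j i

  lin-δ : ∀ {n r} (j : Fin r) (g : Fin r → Word n) x → lin (δ j) g x ≈ g j x
  lin-δ zero    g x = trans
    (+-cong (*-identityˡ (g zero x)) (lin-zero (λ _ → 0#) (g ∘ suc) x (λ i → zeroˡ (g (suc i) x))))
    (+-identityʳ (g zero x))
  lin-δ (suc j) g x = trans (+-cong (zeroˡ (g zero x)) (lin-δ j (g ∘ suc) x)) (+-identityˡ (g (suc j) x))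

  inSpan-member : ∀ {n r} (g : Fin r → Word n) j → InSpan g (g j)
  inSpan-member g j = δ j , λ x → sym (lin-δ j g x)

  lin-+* : ∀ {n r} (a b : Fin r → Carrier) m (g : Fin r → Word n) x →
           lin (λ i → a i + m * b i) g x ≈ lin a g x + m * lin b g x
  lin-+* a b m g x = begin
    Σ.sum (λ i → (a i + m * b i) * g i x)
      ≈⟨ sum-cong-≋ (λ i → trans (distribʳ (g i x) (a i) (m * b i))
                                  (+-congˡ (*-assoc m (b i) (g i x)))) ⟩
    Σ.sum (λ i → a i * g i x + m * (b i * g i x))
      ≈⟨ Σ.∑-distrib-+ (λ i → a i * g i x) (λ i → m * (b i * g i x)) ⟩
    lin a g x + Σ.sum (λ i → m * (b i * g i x))
      ≈⟨ +-congˡ (Σ.*-distribˡ-sum m (λ i → b i * g i x)) ⟨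
    lin a g x + m * lin b g x ∎

  lin-shear : ∀ {n r} (μ m : Fin r → Carrier) (g : Fin r → Word n) (h : Word n) x →
              lin μ (λ i y → g i y + m i * h y) x ≈ lin μ g x + Σ.sum (λ i → μ i * m i) * h x
  lin-shear μ m g h x = begin
    Σ.sum (λ i → μ i * (g i x + m i * h x))
      ≈⟨ sum-cong-≋ (λ i → trans (distribˡ (μ i) (g i x) (m i * h x))
                                  (+-congˡ (sym (*-assoc (μ i) (m i) (h x))))) ⟩
    Σ.sum (λ i → μ i * g i x + μ i * m i * h x)
      ≈⟨ Σ.∑-distrib-+ (λ i → μ i * g i x) (λ i → μ i * m i * h x) ⟩
    lin μ g x + Σ.sum (λ i → μ i * m i * h x)
      ≈⟨ +-congˡ (*-distribʳ-sum (h x) (λ i → μ i * m i)) ⟨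
    lin μ g x + Σ.sum (λ i → μ i * m i) * h x ∎

  inSpan-tail : ∀ {n k} (G : Fin (suc k) → Word n) {c : Word n} (a : Fin (suc k) → Carrier) →
                (∀ x → c x ≈ lin a G x) → a zero ≈ 0# → InSpan (G ∘ suc) c
  inSpan-tail G a c≈aG a₀≈0 = a ∘ suc , λ x →
    trans (c≈aG x) (trans (+-congʳ (trans (*-congʳ a₀≈0) (zeroˡ (G zero x)))) (+-identityˡ _))

  inSpan-eliminate : ∀ {n k} (G : Fin (suc k) → Word n) {c d : Word n}
                     (a b : Fin (suc k) → Carrier) m →
                     (∀ x → c x ≈ lin a G x) → (∀ x → d x ≈ lin b G x) →
                     a zero + m * b zero ≈ 0# → InSpan (G ∘ suc) (λ x → c x + m * d x)
  inSpan-eliminate G a b m c≈aG d≈bG killed = inSpan-tail G (λ i → a i + m * b i)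
    (λ x → trans (+-cong (c≈aG x) (*-congˡ (d≈bG x))) (sym (lin-+* a b m G x))) killed

  linIndep-shear : ∀ {n r} (B : Fin (suc r) → Word n) → LinIndep B →
                   ∀ j (m : Fin r → Carrier) → LinIndep (λ i x → B (punchIn j i) x + m i * B j x)
  linIndep-shear B indep j m μ μB′≈0 i =
    trans (sym (reflexive (insertAt-punchIn μ j s i))) (indep ν νB≈0 (punchIn j i))
    where
    s = Σ.sum (λ i → μ i * m i)
    ν = Vector.insertAt μ j s
    νB≈0 : ∀ x → lin ν B x ≈ 0#
    νB≈0 x = begin
      lin ν B x
        ≈⟨ Σ.sum-remove {i = j} (λ i → ν i * B i x) ⟩
      ν j * B j x + lin (ν ∘ punchIn j) (B ∘ punchIn j) x
        ≈⟨ +-cong (*-congʳ (reflexive (insertAt-lookup μ j s)))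
                  (lin-cong (B ∘ punchIn j) x (reflexive ∘ insertAt-punchIn μ j s)) ⟩
      s * B j x + lin μ (B ∘ punchIn j) x
        ≈⟨ +-comm _ _ ⟩
      lin μ (B ∘ punchIn j) x + s * B j x
        ≈⟨ lin-shear μ m (B ∘ punchIn j) (B j) x ⟨
      lin μ (λ i y → B (punchIn j i) y + m i * B j y) x
        ≈⟨ μB′≈0 x ⟩
      0# ∎

  -- Steinitz exchange: pivot on some B j whose coefficient on G zero is nonzero and subtract
  -- multiples of it from the other r vectors; they stay independent and lie in the span of G ∘ suc.
  linIndep-inSpan⇒≤ : ∀ {n} k r (G : Fin k → Word n) (B : Fin r → Word n) →
                      LinIndep B → (∀ j → InSpan G (B j)) → r ≤ k
  linIndep-inSpan⇒≤ k       zero    G B indep B∈G = z≤n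
  linIndep-inSpan⇒≤ zero    (suc r) G B indep B∈G =
    contradiction (indep (δ zero) (λ x → trans (lin-δ zero B x) (proj₂ (B∈G zero) x)) zero) 1≉0
  linIndep-inSpan⇒≤ (suc k) (suc r) G B indep B∈G with nonzero? (λ j → proj₁ (B∈G j) zero)
  ... | no ¬nz = m≤n⇒m≤1+n (linIndep-inSpan⇒≤ k (suc r) (G ∘ suc) B indep
          (λ j → inSpan-tail G (proj₁ (B∈G j)) (proj₂ (B∈G j)) (¬nonzero⇒≈0 ¬nz j)))
  ... | yes (j , p≉0) with inverse _ p≉0
  ... | p⁻¹ , pp⁻¹≈1 =
    s≤s (linIndep-inSpan⇒≤ k r (G ∘ suc) _ (linIndep-shear B indep j m) B′∈G)
    where
    a : Fin (suc r) → Fin (suc k) → Carrier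
    a i = proj₁ (B∈G i)
    m : Fin r → Carrier
    m i = - (a (punchIn j i) zero * p⁻¹)
    B′∈G : ∀ i → InSpan (G ∘ suc) (λ x → B (punchIn j i) x + m i * B j x)
    B′∈G i = inSpan-eliminate G (a (punchIn j i)) (a j) (m i)
               (proj₂ (B∈G (punchIn j i))) (proj₂ (B∈G j))
               (trans (+-comm _ _) (affine-root-zero (a (punchIn j i) zero) pp⁻¹≈1))

  linIndep-∷ : ∀ {n r} {c : Word n} {B : Fin r → Word n} x →
               ¬ c x ≈ 0# → (∀ j → B j x ≈ 0#) → LinIndep B → LinIndep (c Vector.∷ B)
  linIndep-∷ {c = c} {B} x cx≉0 Bx≈0 indep μ μcB≈0 =
    λ { zero → μ₀≈0 ; (suc j) → indep (μ ∘ suc) μB≈0 j }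
    where
    μ₀≈0 : μ zero ≈ 0#
    μ₀≈0 = x*y≈0⇒y≈0 cx≉0 (begin
      c x * μ zero                    ≈⟨ *-comm _ _ ⟩
      μ zero * c x                    ≈⟨ +-identityʳ _ ⟨
      μ zero * c x + 0#               ≈⟨ +-congˡ (lin-zeroʳ (μ ∘ suc) B x Bx≈0) ⟨
      lin μ (c Vector.∷ B) x          ≈⟨ μcB≈0 x ⟩
      0#                              ∎)
    μB≈0 : ∀ y → lin (μ ∘ suc) B y ≈ 0#
    μB≈0 y = begin
      lin (μ ∘ suc) B y               ≈⟨ +-identityˡ _ ⟨
      0# + lin (μ ∘ suc) B y          ≈⟨ +-congʳ (trans (*-congʳ μ₀≈0) (zeroˡ (c y))) ⟨
      lin μ (c Vector.∷ B) y          ≈⟨ μcB≈0 y ⟩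
      0#                              ∎

  fullSubcode-InSupp : ∀ {n k} (G B : Fin k → Word n) → IsSubcode G B →
                       ∀ {x} i → ¬ G i x ≈ 0# → InSupp B x
  fullSubcode-InSupp {k = k} G B (indep , B∈G) {x} i Gᵢx≉0 with nonzero? (λ j → B j x)
  ... | yes (j , Bⱼx≉0) = B j , inSpan-member B j , Bⱼx≉0
  ... | no ¬nz = contradiction
    (linIndep-inSpan⇒≤ k (suc k) G (G i Vector.∷ B)
       (linIndep-∷ {c = G i} {B} x Gᵢx≉0 (¬nonzero⇒≈0 ¬nz) indep)
       λ { zero → inSpan-member G i ; (suc j) → B∈G j })
    1+n≰n

  InSupp-word : ∀ {n} (c : Word n) x → InSupp {r = 1} (λ _ → c) x ⇔ (¬ c x ≈ 0#)
  InSupp-word c x = mk⇔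
    (λ { (c′ , (λs , c′≈λs·c) , c′x≉0) cx≈0 →
         c′x≉0 (trans (c′≈λs·c x) (lin-zeroʳ λs (λ _ → c) x (λ _ → cx≈0))) })
    (λ cx≉0 → c , inSpan-member (λ _ → c) zero , cx≉0)

  index : Carrier → Fin q
  index y = proj₁ (enum-sur y)

  enum-index : ∀ y → enum (index y) ≈ y
  enum-index y = proj₂ (enum-sur y)

  2≤q : 2 ≤ q
  2≤q = 2≤-of-distinct {i = index 0#} {index 1#} λ eq →
    1≉0 (trans (sym (enum-index 1#)) (trans (reflexive (≡.cong enum (≡.sym eq))) (enum-index 0#)))

  linIndep-single : ∀ {n} {c : Word n} → ¬ IsZeroWord c → LinIndep {r = 1} (λ _ → c)
  linIndep-single {c = c} c≉0 with nonzero-entry c c≉0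
  ... | x , cx≉0 = linIndep-∷ {c = c} {λ ()} x cx≉0 (λ ()) (λ _ _ ())

  coeff : ∀ {k} → Vec (Fin q) k → Fin k → Carrier
  coeff v i = enum (lookup v i)

  codeword : ∀ {n k} → (Fin k → Word n) → Vec (Fin q) k → Word n
  codeword G v = lin (coeff v) G

  zeroCoeffs : ∀ k → Vec (Fin q) k
  zeroCoeffs k = tabulate (λ _ → index 0#)

  inSpan⇒codeword : ∀ {n k} (G : Fin k → Word n) {c} → InSpan G c →
                    ∃ λ v → ∀ x → c x ≈ codeword G v x
  inSpan⇒codeword G (λs , c≈λs·G) =
    tabulate (index ∘ λs) , λ x → trans (c≈λs·G x) (lin-cong G x coeff≈)
    where
    coeff≈ : ∀ i → λs i ≈ coeff (tabulate (index ∘ λs)) i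
    coeff≈ i = sym (trans (reflexive (≡.cong enum (lookup∘tabulate (index ∘ λs) i)))
                          (enum-index (λs i)))

  codeword≈0⇒zeroCoeffs : ∀ {n k} (G : Fin k → Word n) → LinIndep G →
                          ∀ v → IsZeroWord (codeword G v) → v ≡ zeroCoeffs k
  codeword≈0⇒zeroCoeffs G indep v v·G≈0 =
    ≡.trans (≡.sym (tabulate∘lookup v)) (tabulate-cong vᵢ≡0)
    where
    vᵢ≡0 : ∀ i → lookup v i ≡ index 0#
    vᵢ≡0 i = enum-inj _ _ (trans (indep (coeff v) v·G≈0 i) (sym (enum-index 0#)))

  codeword-∷ : ∀ {n k} (G : Fin (suc k) → Word n) t v x → G zero x ≈ 0# →
               codeword G (t ∷ v) x ≈ codeword (G ∘ suc) v x
  codeword-∷ G t v x G₀x≈0 =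
    trans (+-congʳ (trans (*-congˡ G₀x≈0) (zeroʳ (enum t)))) (+-identityˡ _)

  affine-root-unique : ∀ {a} s → ¬ a ≈ 0# →
                       ∃ λ t₀ → ∀ t → (enum t * a + s ≈ 0# ⇔ t ≡ t₀)
  affine-root-unique s a≉0 with inverse _ a≉0
  ... | a⁻¹ , aa⁻¹≈1 = index r , λ t → mk⇔
    (λ root → enum-inj t (index r) (trans (affine-root aa⁻¹≈1 root) (sym (enum-index r))))
    (λ { ≡.refl → trans (+-congʳ (*-congʳ (enum-index r))) (affine-root-zero s aa⁻¹≈1) })
    where r = - (s * a⁻¹)

module Weights {q : ℕ} (F : FiniteField q) where

  open import Data.Nat using (_+_; _*_; _∸_; _^_)
  open import Data.Nat.Properties as ℕ using ()
  open import Data.Fin.Properties using (nonZeroIndex)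
  open import Data.Fin.Subset using (∣_∣)
  open import Data.Fin.Subset.Properties using (_∈?_)
  import Data.Fin as Fin
  open import Data.Vec.Properties using (≡-dec)
  import Function.Properties.Equivalence as ⇔
  open import Relation.Binary.PropositionalEquality
    using (refl; sym; trans; cong; cong₂; module ≡-Reasoning)
  open import Algebra.Properties.Semiring.Sum ℕ.+-*-semiring
    using (sum-syntax; sum-cong-≗; *-distribˡ-sum)

  open FiniteField F using (Carrier; _≈_; _≟_; 0#)
    renaming (refl to ≈-refl; sym to ≈-sym; trans to ≈-trans)
  open Codes F
  open Counting
  open VectorSum q
  open LinearAlgebra F

  𝟙≉0 : Carrier → ℕ
  𝟙≉0 y = 𝟙 (¬? (y ≟ 0#))

  𝟙≉0-cong : ∀ {y y′} → y ≈ y′ → 𝟙≉0 y ≡ 𝟙≉0 y′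
  𝟙≉0-cong y≈y′ = 𝟙-cong _ _ (mk⇔
    (λ y≉0 y′≈0 → y≉0 (≈-trans y≈y′ y′≈0))
    (λ y′≉0 y≈0 → y′≉0 (≈-trans (≈-sym y≈y′) y≈0)))

  𝟙≉0-zero : ∀ {y} → y ≈ 0# → 𝟙≉0 y ≡ 0
  𝟙≉0-zero y≈0 = 𝟙-no _ (λ y≉0 → y≉0 y≈0)

  weight : ∀ {n} → Word n → ℕ
  weight {n} c = ∑[ x < n ] 𝟙≉0 (c x)

  weight-cong : ∀ {n} {c c′ : Word n} → (∀ x → c x ≈ c′ x) → weight c ≡ weight c′
  weight-cong c≈c′ = sum-cong-≗ (λ x → 𝟙≉0-cong (c≈c′ x))

  wordWeight : ∀ {n} (c : Word n) → WordWeight c (weight c)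
  wordWeight c = toSubset c≉0? , ∣∣≡∑𝟙 _ c≉0? (∈-toSubset c≉0?) ,
                 λ x → ⇔.trans (∈-toSubset c≉0? x) (⇔.sym (InSupp-word c x))
    where c≉0? = λ x → ¬? (c x ≟ 0#)

  WordWeight⇒≡weight : ∀ {n} {c : Word n} {m} → WordWeight c m → m ≡ weight c
  WordWeight⇒≡weight {c = c} (S , ∣S∣≡m , S⇔Supp) = trans (sym ∣S∣≡m)
    (∣∣≡∑𝟙 S (λ x → ¬? (c x ≟ 0#)) (λ x → ⇔.trans (S⇔Supp x) (InSupp-word c x)))

  supportSize : ∀ {n k} → (Fin k → Word n) → ℕ
  supportSize {n} G = ∑[ x < n ] 𝟙 (nonzero? (λ i → G i x))

  supportSize≤ : ∀ {n k} (G B : Fin k → Word n) → IsSubcode G B →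
                 ∀ {m} → HasWeight B m → supportSize G ≤ m
  supportSize≤ {n} G B B⊆G {m} (S , ∣S∣≡m , S⇔Supp) = begin
    supportSize G
      ≤⟨ sum-mono-≤ (λ x → 𝟙-mono (nonzero? _) (x ∈? S) λ (i , Gᵢx≉0) →
           Equivalence.from (S⇔Supp x) (fullSubcode-InSupp G B B⊆G i Gᵢx≉0)) ⟩
    ∑[ x < n ] 𝟙 (x ∈? S)
      ≡⟨ ∣∣≡∑𝟙 S (_∈? S) (λ _ → ⇔.refl) ⟨
    ∣ S ∣
      ≡⟨ ∣S∣≡m ⟩
    m ∎
    where open ℕ.≤-Reasoning

  column-count : ∀ {n} k (G : Fin (suc k) → Word n) x → ∃ (λ i → ¬ G i x ≈ 0#) →
                 ∑ⱽ (suc k) (λ v → 𝟙≉0 (codeword G v x)) ≡ q ^ k * (q ∸ 1)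
  column-count k G x _ with G zero x ≟ 0#
  column-count k G x _ | no G₀x≉0 = begin
    ∑[ t < q ] ∑ⱽ k (λ v → 𝟙≉0 (codeword G (t ∷ v) x))
      ≡⟨ ∑ⱽ-comm k (λ v t → 𝟙≉0 (codeword G (t ∷ v) x)) ⟨
    ∑ⱽ k (λ v → ∑[ t < q ] 𝟙≉0 (codeword G (t ∷ v) x))
      ≡⟨ ∑ⱽ-cong k (λ v → uncurry (∑𝟙¬≡n∸1 (λ t → codeword G (t ∷ v) x ≟ 0#))
                                  (affine-root-unique (codeword (G ∘ suc) v x) G₀x≉0)) ⟩
    ∑ⱽ k (λ _ → q ∸ 1)
      ≡⟨ ∑ⱽ-const k (q ∸ 1) ⟩
    q ^ k * (q ∸ 1) ∎
    where open ≡-Reasoning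
  column-count k       G x (zero  , G₀x≉0) | yes G₀x≈0 = contradiction G₀x≈0 G₀x≉0
  column-count (suc k) G x (suc i , Gᵢx≉0) | yes G₀x≈0 = begin
    ∑[ t < q ] ∑ⱽ (suc k) (λ v → 𝟙≉0 (codeword G (t ∷ v) x))
      ≡⟨ sum-cong-≗ {q} (λ t → ∑ⱽ-cong (suc k) (λ v → 𝟙≉0-cong (codeword-∷ G t v x G₀x≈0))) ⟩
    ∑[ t < q ] ∑ⱽ (suc k) (λ v → 𝟙≉0 (codeword (G ∘ suc) v x))
      ≡⟨ sum-cong-≗ {q} (λ _ → column-count k (G ∘ suc) x (i , Gᵢx≉0)) ⟩
    ∑[ t < q ] (q ^ k * (q ∸ 1))
      ≡⟨ sum-const q _ ⟩
    q * (q ^ k * (q ∸ 1))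
      ≡⟨ ℕ.*-assoc q (q ^ k) (q ∸ 1) ⟨
    q ^ suc k * (q ∸ 1) ∎
    where open ≡-Reasoning

  column-weight : ∀ {n} k (G : Fin (suc k) → Word n) x →
                  ∑ⱽ (suc k) (λ v → 𝟙≉0 (codeword G v x))
                    ≡ q ^ k * (q ∸ 1) * 𝟙 (nonzero? (λ i → G i x))
  column-weight k G x with nonzero? (λ i → G i x)
  ... | yes nz  = trans (column-count k G x nz) (sym (ℕ.*-identityʳ _))
  ... | no  ¬nz = begin
    ∑ⱽ (suc k) (λ v → 𝟙≉0 (codeword G v x))
      ≡⟨ ∑ⱽ-cong (suc k) (λ v → 𝟙≉0-zero (lin-zeroʳ (coeff v) G x (¬nonzero⇒≈0 ¬nz))) ⟩
    ∑ⱽ (suc k) (λ _ → 0)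
      ≡⟨ ∑ⱽ-const (suc k) 0 ⟩
    q ^ suc k * 0
      ≡⟨ ℕ.*-zeroʳ (q ^ suc k) ⟩
    0
      ≡⟨ ℕ.*-zeroʳ (q ^ k * (q ∸ 1)) ⟨
    q ^ k * (q ∸ 1) * 0 ∎
    where open ≡-Reasoning

  weight-sum : ∀ {n} k (G : Fin (suc k) → Word n) →
               ∑ⱽ (suc k) (λ v → weight (codeword G v)) ≡ q ^ k * (q ∸ 1) * supportSize G
  weight-sum {n} k G = begin
    ∑ⱽ (suc k) (λ v → ∑[ x < n ] 𝟙≉0 (codeword G v x))
      ≡⟨ ∑ⱽ-comm (suc k) (λ v x → 𝟙≉0 (codeword G v x)) ⟩
    ∑[ x < n ] ∑ⱽ (suc k) (λ v → 𝟙≉0 (codeword G v x))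
      ≡⟨ sum-cong-≗ {n} (column-weight k G) ⟩
    ∑[ x < n ] (q ^ k * (q ∸ 1) * 𝟙 (nonzero? (λ i → G i x)))
      ≡⟨ *-distribˡ-sum (q ^ k * (q ∸ 1)) (λ x → 𝟙 (nonzero? (λ i → G i x))) ⟨
    q ^ k * (q ∸ 1) * supportSize G ∎
    where open ≡-Reasoning

  weight≡-of-supportSize≤ : ∀ {n} k (G : Fin (suc k) → Word n) → LinIndep G → ∀ a →
                            (∀ c → InSpan G c → ¬ IsZeroWord c → a ≤ weight c) →
                            supportSize G * (q ^ k * (q ∸ 1)) ≤ a * (q ^ suc k ∸ 1) →
                            ∀ c → InSpan G c → ¬ IsZeroWord c → weight c ≡ a
  weight≡-of-supportSize≤ k G indep a a≤weight support≤ c c∈G c≉0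
    with inSpan⇒codeword G c∈G
  ... | v , c≈v·G = ℕ.≤-antisym weight≤a (a≤weight c c∈G c≉0)
    where
    open ℕ.≤-Reasoning
    K = suc k

    isZero? : (u : Vec (Fin q) K) → Dec (u ≡ zeroCoeffs K)
    isZero? u = ≡-dec Fin._≟_ u (zeroCoeffs K)

    -- The zero vector is charged a as well, so that a ≤ f everywhere.
    f : Vec (Fin q) K → ℕ
    f u = weight (codeword G u) + a * 𝟙 (isZero? u)

    a≤f : ∀ u → a ≤ f u
    a≤f u with isZero? u
    ... | yes _   = ℕ.≤-trans (ℕ.≤-reflexive (sym (ℕ.*-identityʳ a))) (ℕ.m≤n+m _ _)
    ... | no  u≢0 = ℕ.≤-trans
      (a≤weight (codeword G u) (coeff u , λ _ → ≈-refl) (u≢0 ∘ codeword≈0⇒zeroCoeffs G indep u))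
      (ℕ.m≤m+n _ _)

    ∑f≤∑a : ∑ⱽ K f ≤ ∑ⱽ K (λ _ → a)
    ∑f≤∑a = begin
      ∑ⱽ K f
        ≡⟨ ∑ⱽ-distrib-+ K (λ u → weight (codeword G u)) (λ u → a * 𝟙 (isZero? u)) ⟩
      ∑ⱽ K (λ u → weight (codeword G u)) + ∑ⱽ K (λ u → a * 𝟙 (isZero? u))
        ≡⟨ cong₂ _+_ (weight-sum k G)
                     (trans (∑ⱽ-*ˡ K a (𝟙 ∘ isZero?)) (cong (a *_) (∑ⱽ-𝟙≡ K (zeroCoeffs K)))) ⟩
      q ^ k * (q ∸ 1) * supportSize G + a * 1
        ≤⟨ ℕ.+-monoˡ-≤ (a * 1) (ℕ.≤-trans (ℕ.≤-reflexive (ℕ.*-comm _ (supportSize G))) support≤) ⟩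
      a * (q ^ K ∸ 1) + a * 1
        ≡⟨ ℕ.*-distribˡ-+ a (q ^ K ∸ 1) 1 ⟨
      a * (q ^ K ∸ 1 + 1)
        ≡⟨ cong (a *_) (ℕ.m∸n+n≡m (ℕ.m^n>0 q {{nonZeroIndex (index 0#)}} K)) ⟩
      a * q ^ K
        ≡⟨ ℕ.*-comm a (q ^ K) ⟩
      q ^ K * a
        ≡⟨ ∑ⱽ-const K a ⟨
      ∑ⱽ K (λ _ → a) ∎

    weight≤a : weight c ≤ a
    weight≤a = begin
      weight c               ≡⟨ weight-cong c≈v·G ⟩
      weight (codeword G v)  ≤⟨ ℕ.m≤m+n _ _ ⟩
      f v                    ≤⟨ ∑ⱽ-tight K a≤f ∑f≤∑a v ⟩
      a                      ∎

open import Data.Nat using (_*_; _^_; _∸_; >-nonZero)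
open import Data.Integer using (ℤ; +_)
import Data.Nat.Properties as ℕ
import Data.Integer.Properties as ℤ
open import Relation.Binary.PropositionalEquality using (refl; sym; trans; cong; module ≡-Reasoning)

formula₁⇒α≡d₁ : ∀ {q} → 2 ≤ q → ∀ d₁ α →
                (+ d₁) Data.Integer.* (+ (q ^ 0 * (q ∸ 1))) ≡ α Data.Integer.* (+ (q ^ 1 ∸ 1)) →
                α ≡ + d₁
formula₁⇒α≡d₁ {q} 2≤q d₁ α formula₁ =
  sym (ℤ.*-cancelʳ-≡ (+ d₁) α (+ (q ∸ 1)) {{>-nonZero (ℕ.∸-monoˡ-≤ 1 2≤q)}} (begin
    + d₁ Data.Integer.* + (q ∸ 1)
      ≡⟨ cong (λ e → + d₁ Data.Integer.* + e) (ℕ.*-identityˡ (q ∸ 1)) ⟨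
    + d₁ Data.Integer.* + (q ^ 0 * (q ∸ 1))
      ≡⟨ formula₁ ⟩
    α Data.Integer.* + (q ^ 1 ∸ 1)
      ≡⟨ cong (λ e → α Data.Integer.* + (e ∸ 1)) (ℕ.*-identityʳ q) ⟩
    α Data.Integer.* + (q ∸ 1) ∎))
  where open ≡-Reasoning

formula-in-ℕ : ∀ {d₁ dᵢ m m′} {α : ℤ} → α ≡ + d₁ →
               (+ dᵢ) Data.Integer.* (+ m) ≡ α Data.Integer.* (+ m′) → dᵢ * m ≡ d₁ * m′
formula-in-ℕ {d₁} {dᵢ} {m} {m′} refl formulaᵢ =
  ℤ.+-injective (trans (ℤ.pos-* dᵢ m) (trans formulaᵢ (sym (ℤ.pos-* d₁ m′))))

corollary2 : ∀ {q : ℕ} (F : FiniteField q) (n k : ℕ)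
    → (G : Fin k → Codes.Word F n) → Codes.LinIndep F G
    → (d : ℕ → ℕ) → (∀ i → 1 ≤ i → i ≤ k → Codes.IsHigherWeight F G i (d i))
    → (α : ℤ)
    → (∀ i → 1 ≤ i → i ≤ k
         → (+ d i) Data.Integer.* (+ (q ^ (i ∸ 1) * (q ∸ 1)))
           ≡ α Data.Integer.* (+ (q ^ i ∸ 1)))
    → Codes.ConstantWeight F G
      × (∀ c → Codes.InSpan F G c → ¬ Codes.IsZeroWord F c
           → ∀ m → Codes.WordWeight F c m → + m ≡ α)
-- The only codeword of the zero code is the empty combination, i.e. zero.
corollary2 F n zero G _ _ _ _ _ =
  (λ c _ _ _ c∈G c≉0 _ _ _ _ → contradiction (proj₂ c∈G) c≉0) ,
  (λ c c∈G c≉0 _ _ → contradiction (proj₂ c∈G) c≉0)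
corollary2 {q} F n (suc k) G indep d d-higher α formula = weights-equal , weight≡α
  where
  open Codes F
  open LinearAlgebra F using (2≤q; linIndep-single)
  open Weights F

  α≡d₁ : α ≡ + d 1
  α≡d₁ = formula₁⇒α≡d₁ 2≤q (d 1) α (formula 1 (s≤s z≤n) (s≤s z≤n))

  d₁≤weight : ∀ c → InSpan G c → ¬ IsZeroWord c → d 1 ≤ weight c
  d₁≤weight c c∈G c≉0 = proj₂ (d-higher 1 (s≤s z≤n) (s≤s z≤n))
    (λ _ → c) (linIndep-single c≉0 , λ _ → c∈G) (weight c) (wordWeight c)

  support≤ : supportSize G * (q ^ k * (q ∸ 1)) ≤ d 1 * (q ^ suc k ∸ 1)
  support≤ with proj₁ (d-higher (suc k) (s≤s z≤n) ℕ.≤-refl)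
  ... | B , B⊆G , B-weight = ℕ.≤-trans
    (ℕ.*-monoˡ-≤ _ (supportSize≤ G B B⊆G B-weight))
    (ℕ.≤-reflexive (formula-in-ℕ {dᵢ = d (suc k)} α≡d₁ (formula (suc k) (s≤s z≤n) ℕ.≤-refl)))

  m≡d₁ : ∀ c → InSpan G c → ¬ IsZeroWord c → ∀ m → WordWeight c m → m ≡ d 1
  m≡d₁ c c∈G c≉0 m c-weight = trans (WordWeight⇒≡weight c-weight)
    (weight≡-of-supportSize≤ k G indep (d 1) d₁≤weight support≤ c c∈G c≉0)

  weights-equal : ConstantWeight G
  weights-equal c c′ m m′ c∈G c≉0 c′∈G c′≉0 c-weight c′-weight =
    trans (m≡d₁ c c∈G c≉0 m c-weight) (sym (m≡d₁ c′ c′∈G c′≉0 m′ c′-weight))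

  weight≡α : ∀ c → InSpan G c → ¬ IsZeroWord c → ∀ m → WordWeight c m → + m ≡ α
  weight≡α c c∈G c≉0 m c-weight = trans (cong +_ (m≡d₁ c c∈G c≉0 m c-weight)) (sym α≡d₁)
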